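{- The algebra $\langle\mathbb N;+\rangle$ is sp-residually finite, whereas $\langle\mathbb Z;+\rangle$ is c-residually finite but not sp-residually finite.
   Context: For an algebra, congruences are equivalence relations compatible with all operations, stable preorders are reflexive transitive relations compatible with all operations; the index of a stable preorder is the number of classes of its associated congruence $\{(x,y):x\preceq y,y\preceq x\}$. An algebra is c-residually finite if every congruence is an intersection of finite index congruences, and sp-residually finite if every stable preorder is an intersection of finite index stable preorders. -}

module Defs where

open import Level using (0ℓ)
open import Data.Nat using (ℕ)
open import Data.Fin using (Fin)
open import Data.Product using (Σ; ∃; _×_; _,_)
open import Relation.Binary.Core using (Rel)
open import Function.Bundles using (_⇔_)

module _ {A : Set} (_∙_ : A → A → A) where

  Compatible : Rel A 0ℓ → Set
  Compatible R = ∀ {x y x′ y′} → R x y → R x′ y′ → R (x ∙ x′) (y ∙ y′)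

  record IsCongruence (R : Rel A 0ℓ) : Set where
    field
      refl′      : ∀ x → R x x
      sym′       : ∀ {x y} → R x y → R y x
      trans′     : ∀ {x y z} → R x y → R y z → R x z
      compatible : Compatible R

  record IsStablePreorder (R : Rel A 0ℓ) : Set where
    field
      refl′      : ∀ x → R x x
      trans′     : ∀ {x y z} → R x y → R y z → R x z
      compatible : Compatible R

  assocCong : Rel A 0ℓ → Rel A 0ℓ
  assocCong R x y = R x y × R y x

  FinitelyManyClasses : Rel A 0ℓ → Set
  FinitelyManyClasses E = Σ ℕ λ n → Σ (Fin n → A) λ r → ∀ x → ∃ λ i → E x (r i)

  FiniteIndexCongruence : Rel A 0ℓ → Set
  FiniteIndexCongruence R = IsCongruence R × FinitelyManyClasses R

  -- index of a stable preorder = number of classes of its associated congruence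
  FiniteIndexStablePreorder : Rel A 0ℓ → Set
  FiniteIndexStablePreorder R = IsStablePreorder R × FinitelyManyClasses (assocCong R)

  IsIntersectionOf : (Rel A 0ℓ → Set) → Rel A 0ℓ → Set₂
  IsIntersectionOf P R =
    Σ Set₁ λ I → Σ (I → Rel A 0ℓ) λ F →
      (∀ i → P (F i)) × (∀ x y → (R x y ⇔ (∀ i → F i x y)))

  c-ResiduallyFinite : Set₂
  c-ResiduallyFinite = ∀ R → IsCongruence R → IsIntersectionOf FiniteIndexCongruence R

  sp-ResiduallyFinite : Set₂
  sp-ResiduallyFinite = ∀ R → IsStablePreorder R → IsIntersectionOf FiniteIndexStablePreorder R

{-# OPTIONS --safe #-}

-- On ⟨ℕ;+⟩ a stable preorder R is cut out by the stable preorders generated by R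
-- together with x ≼ x + p ≼ x for all x ≥ N; each has at most N + p classes. If a ≼ b
-- holds in all of them, the one with N > a + b shows that either R a b, or R moves a up
-- to some a + d and brings some b + e down to b (d, e > 0). Then d·e is a period of R
-- from a + b on, so the preorder generated with N = a + b and p = d·e is R itself.
--
-- On ⟨ℤ;+⟩ a congruence R is determined by its kernel {h | h R 0}, and it is cut out by
-- its joins with ≡ (mod p). A modulus p > |a − b| yields a kernel element g ≡ a − b
-- (mod p), which vanishes only when a = b; otherwise |g| is a modulus lying in the
-- kernel, and the join of R with ≡ (mod |g|) is R itself.
--
-- The order ≤ on ℤ is no such intersection: in a finite-index stable preorder F ⊇ ≤,
-- an integer M above all class representatives is equivalent to one of them, r < M,
-- so F (M − r) 0 with 1 ≤ M − r, i.e. F 1 0.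

module Submission where

open import Defs
open import Data.Product using (_×_; _,_; ∃; proj₁; proj₂)
open import Relation.Nullary using (¬_)
open import Data.Nat using () renaming (_+_ to _+ℕ_)
open import Data.Integer using () renaming (_+_ to _+ℤ_)

open import Level using (0ℓ; Lift; lift; lower)
open import Data.Sum using (_⊎_; inj₁; inj₂)
open import Data.Fin using (toℕ; fromℕ<)
open import Data.Fin.Properties using (toℕ<n; toℕ-fromℕ<)
open import Function using (_∘_; flip)
open import Function.Bundles using (mk⇔)
open import Relation.Nullary using (yes; no; contradiction)
open import Relation.Binary.Core using (Rel; _⇒_)
open import Relation.Binary.Definitions using (Reflexive; Transitive)
open import Relation.Binary.PropositionalEquality
  using (_≡_; refl; sym; trans; cong; subst; module ≡-Reasoning)
open import Relation.Binary.Construct.Union using (_∪_)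
open import Relation.Binary.Construct.Closure.Symmetric using (SymClosure; fwd; bwd)
open import Relation.Binary.Construct.Closure.ReflexiveTransitive
  using (Star; ε; _◅_; _◅◅_; gmap; fold; return)

module _ {A : Set} (_∙_ : A → A → A) where

  TranslationInvariant : Rel A 0ℓ → Set
  TranslationInvariant R = ∀ t {x y} → R x y → R (x ∙ t) (y ∙ t) × R (t ∙ x) (t ∙ y)

  reflexive∧compatible⇒translationInvariant : ∀ {R} →
    Reflexive R → Compatible _∙_ R → TranslationInvariant R
  reflexive∧compatible⇒translationInvariant R-refl compatible t r =
    compatible r R-refl , compatible R-refl r

  ∪-translationInvariant : ∀ {R S} →
    TranslationInvariant R → TranslationInvariant S → TranslationInvariant (R ∪ S)
  ∪-translationInvariant invR invS t (inj₁ r) = inj₁ (proj₁ (invR t r)) , inj₁ (proj₂ (invR t r))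
  ∪-translationInvariant invR invS t (inj₂ s) = inj₂ (proj₁ (invS t s)) , inj₂ (proj₂ (invS t s))

  symClosure-translationInvariant : ∀ {R} →
    TranslationInvariant R → TranslationInvariant (SymClosure R)
  symClosure-translationInvariant inv t (fwd r) = fwd (proj₁ (inv t r)) , fwd (proj₂ (inv t r))
  symClosure-translationInvariant inv t (bwd r) = bwd (proj₁ (inv t r)) , bwd (proj₂ (inv t r))

  star-isStablePreorder : ∀ {R} → TranslationInvariant R → IsStablePreorder _∙_ (Star R)
  star-isStablePreorder inv = record
    { refl′      = λ _ → ε
    ; trans′     = _◅◅_
    ; compatible = λ {_} {y} {x′} p q →
        gmap (_∙ x′) (proj₁ ∘ inv x′) p ◅◅ gmap (y ∙_) (proj₂ ∘ inv y) q
    }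

  flip-isStablePreorder : ∀ {R} → IsStablePreorder _∙_ R → IsStablePreorder _∙_ (flip R)
  flip-isStablePreorder isSP = record
    { refl′      = refl′
    ; trans′     = flip trans′
    ; compatible = compatible
    }
    where open IsStablePreorder isSP

  assocCong-isCongruence : ∀ {R} → IsStablePreorder _∙_ R → IsCongruence _∙_ (assocCong _∙_ R)
  assocCong-isCongruence isSP = record
    { refl′      = λ x → refl′ x , refl′ x
    ; sym′       = λ (r , s) → s , r
    ; trans′     = λ (r , s) (r′ , s′) → trans′ r r′ , trans′ s′ s
    ; compatible = λ (r , s) (r′ , s′) → compatible r r′ , compatible s s′
    }
    where open IsStablePreorder isSP

  isIntersectionOf : ∀ {P R} {I : Set} (F : I → Rel A 0ℓ) →
    (∀ i → P (F i)) → (∀ i → R ⇒ F i) → (∀ {x y} → (∀ i → F i x y) → R x y) →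
    IsIntersectionOf _∙_ P R
  isIntersectionOf {I = I} F P-F R⊆F ⋂F⊆R =
    Lift _ I , F ∘ lower , P-F ∘ lower ,
    λ _ _ → mk⇔ (λ r i → R⊆F (lower i) r) (λ h → ⋂F⊆R (h ∘ lift))

module _ {A : Set} {R S : Rel A 0ℓ} (R-refl : Reflexive R) (R-trans : Transitive R)
         {P : A → Set} (S-inside : ∀ {x y} → S x y → P x × P y) where

  star-∪-escape : ∀ {x y} → Star (R ∪ S) x y →
    R x y ⊎ (∃ λ u → P u × R x u) × (∃ λ v → P v × R v y)
  star-∪-escape ε = inj₁ R-refl
  star-∪-escape (inj₁ r ◅ p) with star-∪-escape p
  ... | inj₁ r′                    = inj₁ (R-trans r r′)
  ... | inj₂ ((u , Pu , r′) , out) = inj₂ ((u , Pu , R-trans r r′) , out)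
  star-∪-escape (inj₂ s ◅ p) with S-inside s | star-∪-escape p
  ... | Px , Py | inj₁ r         = inj₂ ((_ , Px , R-refl) , (_ , Py , r))
  ... | Px , _  | inj₂ (_ , out) = inj₂ ((_ , Px , R-refl) , out)

module Naturals where

  open import Data.Nat
  open import Data.Nat.Properties
  open import Algebra.Properties.CommutativeSemigroup +-commutativeSemigroup using (xy∙z≈xz∙y)

  m<n⇒∃[o]m+[1+o]≡n : ∀ {m n} → m < n → ∃ λ o → m + suc o ≡ n
  m<n⇒∃[o]m+[1+o]≡n {m} m<n with m≤n⇒∃[o]m+o≡n m<n
  ... | o , 1+m+o≡n = o , trans (+-suc m o) 1+m+o≡n

  finitelyManyClasses : ∀ {E m n} →
    IsCongruence _+_ E → m < n → E n m → FinitelyManyClasses _+_ E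
  finitelyManyClasses {E} {m} {n} isCong m<n n~m = n , toℕ , classOf
    where
    open IsCongruence isCong

    representative : ∀ {x y} → y < n → E x y → ∃ λ i → E x (toℕ i)
    representative y<n x~y = fromℕ< y<n , subst (E _) (sym (toℕ-fromℕ< y<n)) x~y

    classOf : ∀ x → ∃ λ i → E x (toℕ i)
    classOf zero = representative (≤-trans (s≤s z≤n) m<n) (refl′ 0)
    classOf (suc x) with classOf x
    ... | i , x~i with suc (toℕ i) <? n
    ...   | yes 1+i<n = representative 1+i<n (compatible (refl′ 1) x~i)
    ...   | no  1+i≮n = representative m<n (trans′ (compatible (refl′ 1) x~i) 1+i~m)
      where
      1+i~m : E (suc (toℕ i)) m
      1+i~m = subst (λ k → E k m) (sym (≤∧≮⇒≡ (toℕ<n i) 1+i≮n)) n~m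

  Step : ℕ → ℕ → Rel ℕ 0ℓ
  Step N p x y = N ≤ x × y ≡ x + p

  step-translationInvariant : ∀ N p → TranslationInvariant _+_ (Step N p)
  step-translationInvariant N p t {x} (N≤x , refl) =
    (m≤n⇒m≤n+o t N≤x , xy∙z≈xz∙y x p t) , (m≤n⇒m≤o+n t N≤x , sym (+-assoc t x p))

  symStep-above : ∀ {N p x y} → SymClosure (Step N p) x y → N ≤ x × N ≤ y
  symStep-above {p = p} (fwd (N≤x , refl)) = N≤x , m≤n⇒m≤n+o p N≤x
  symStep-above {p = p} (bwd (N≤y , refl)) = m≤n⇒m≤n+o p N≤y , N≤y

  module _ {R : Rel ℕ 0ℓ} (isSP : IsStablePreorder _+_ R) where
    open IsStablePreorder isSP

    iterate : ∀ {x d} → R x (x + d) → ∀ k → R x (x + k * d)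
    iterate {x} r zero = subst (R x) (sym (+-identityʳ x)) (refl′ x)
    iterate {x} {d} r (suc k) =
      trans′ r (subst (R (x + d)) shift (compatible (iterate r k) (refl′ d)))
      where
      shift : x + k * d + d ≡ x + suc k * d
      shift = trans (xy∙z≈xz∙y x (k * d) d) (+-assoc x d (k * d))

  module _ {R : Rel ℕ 0ℓ} (isSP : IsStablePreorder _+_ R) where
    open IsStablePreorder isSP

    commonPeriod : ∀ {c d e} → R c (c + d) → R (c + e) c → R c (c + d * e) × R (c + d * e) c
    commonPeriod {c} {d} {e} up down =
      subst (R c) (cong (c +_) (*-comm e d)) (iterate isSP up e) ,
      iterate (flip-isStablePreorder _+_ isSP) down d

    periodicFrom : ∀ {c m} → R c (c + m) → R (c + m) c →
      ∀ {x} → c ≤ x → R x (x + m) × R (x + m) x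
    periodicFrom {c} {m} up down c≤x with m≤n⇒∃[o]m+o≡n c≤x
    ... | t , refl =
      subst (R (c + t)) (xy∙z≈xz∙y c m t) (compatible up (refl′ t)) ,
      subst (λ z → R z (c + t)) (xy∙z≈xz∙y c m t) (compatible down (refl′ t))

  module _ (R : Rel ℕ 0ℓ) (isSP : IsStablePreorder _+_ R) where
    open IsStablePreorder isSP

    Closure : ℕ → ℕ → Rel ℕ 0ℓ
    Closure N p = Star (R ∪ SymClosure (Step N p))

    closure-isStablePreorder : ∀ N p → IsStablePreorder _+_ (Closure N p)
    closure-isStablePreorder N p = star-isStablePreorder _+_
      (∪-translationInvariant _+_
        (reflexive∧compatible⇒translationInvariant _+_ (λ {x} → refl′ x) compatible)
        (symClosure-translationInvariant _+_ (step-translationInvariant N p)))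

    closure-finiteIndex : ∀ N p → FiniteIndexStablePreorder _+_ (Closure N (suc p))
    closure-finiteIndex N p =
      isSP′ , finitelyManyClasses (assocCong-isCongruence _+_ isSP′) (m<m+n N z<s) (back , forth)
      where
      isSP′ : IsStablePreorder _+_ (Closure N (suc p))
      isSP′ = closure-isStablePreorder N (suc p)
      back : Closure N (suc p) (N + suc p) N
      back = return (inj₂ (bwd (≤-refl , refl)))
      forth : Closure N (suc p) N (N + suc p)
      forth = return (inj₂ (fwd (≤-refl , refl)))

    closure⊆R : ∀ {c m} → R c (c + m) → R (c + m) c → Closure c m ⇒ R
    closure⊆R {c} {m} up down = fold R (λ g r → trans′ (generator⊆R g) r) (λ {x} → refl′ x)
      where
      generator⊆R : R ∪ SymClosure (Step c m) ⇒ R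
      generator⊆R (inj₁ r)                  = r
      generator⊆R (inj₂ (fwd (c≤x , refl))) = proj₁ (periodicFrom isSP up down c≤x)
      generator⊆R (inj₂ (bwd (c≤y , refl))) = proj₂ (periodicFrom isSP up down c≤y)

    ⋂closure⊆R : ∀ {a b} → (∀ N p → Closure N (suc p) a b) → R a b
    ⋂closure⊆R {a} {b} h
      with star-∪-escape (λ {x} → refl′ x) trans′ symStep-above (h (suc (a + b)) 0)
    ... | inj₁ r = r
    ... | inj₂ ((u , a+b<u , a≼u) , (v , a+b<v , v≼b))
      with m<n⇒∃[o]m+[1+o]≡n (≤-trans (s≤s (m≤m+n a b)) a+b<u)
         | m<n⇒∃[o]m+[1+o]≡n (≤-trans (s≤s (m≤n+m b a)) a+b<v)
    ... | d , refl | e , refl = closure⊆R (proj₁ period) (proj₂ period) (h (a + b) (e + d * suc e))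
      where
      up : R (a + b) (a + b + suc d)
      up = subst (R (a + b)) (xy∙z≈xz∙y a (suc d) b) (compatible a≼u (refl′ b))
      down : R (a + b + suc e) (a + b)
      down = subst (λ z → R z (a + b)) (sym (+-assoc a b (suc e))) (compatible (refl′ a) v≼b)
      period : R (a + b) (a + b + suc d * suc e) × R (a + b + suc d * suc e) (a + b)
      period = commonPeriod isSP up down

  +-spResiduallyFinite : sp-ResiduallyFinite _+_
  +-spResiduallyFinite R isSP = isIntersectionOf _+_ {P = FiniteIndexStablePreorder _+_}
    (λ (N , p) → Closure R isSP N (suc p))
    (λ (N , p) → closure-finiteIndex R isSP N p)
    (λ _ r → return (inj₁ r))
    (λ h → ⋂closure⊆R R isSP (λ N p → h (N , p)))

module Integers where

  open import Data.Nat as ℕ using (ℕ; zero; suc)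
  open import Data.Nat.Properties using (m≢1+m+n)
  open import Data.Integer hiding (suc)
  open import Data.Integer.Properties
  open import Data.Integer.DivMod using (_%_; _/_; n%d<d; a≡a%n+[a/n]*n)
  open import Data.Integer.Tactic.RingSolver using (solve-∀)
  open import Data.List using (tabulate)
  open import Data.List.Extrema ≤-totalOrder using (max; xs≤max)
  open import Data.List.Relation.Unary.All.Properties using (tabulate⁻)
  open import Function.Bundles using (Equivalence)
  open import Relation.Binary.PropositionalEquality using (subst₂)
  open ≡-Reasoning

  cancel-multiple : ∀ x k p → x + k * p + (- k) * p ≡ x
  cancel-multiple = solve-∀

  merge-multiples : ∀ x k l p → x + k * p + l * p ≡ x + (k + l) * p
  merge-multiples = solve-∀

  interchange-multiples : ∀ x k x′ l p → x + k * p + (x′ + l * p) ≡ x + x′ + (k + l) * p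
  interchange-multiples = solve-∀

  add-multiple-and-cancel : ∀ i j k p → i - j ≡ i + k * p - j + (- k) * p
  add-multiple-and-cancel = solve-∀

  n≡m*[1+n]⇒n≡0 : ∀ {m n} → n ≡ m ℕ.* suc n → n ≡ 0
  n≡m*[1+n]⇒n≡0 {zero}      n≡0 = n≡0
  n≡m*[1+n]⇒n≡0 {suc m} {n} n≡[1+m]*[1+n] = contradiction n≡[1+m]*[1+n] (m≢1+m+n n)

  i+k*[1+∣i-j∣]-j≡0⇒i≡j : ∀ i j k → i + k * + suc ∣ i - j ∣ - j ≡ 0ℤ → i ≡ j
  i+k*[1+∣i-j∣]-j≡0⇒i≡j i j k e =
    i-j≡0⇒i≡j i j (∣i∣≡0⇒i≡0 (n≡m*[1+n]⇒n≡0 {∣ - k ∣} (trans (cong ∣_∣ i-j≡-k*P) (abs-* (- k) P))))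
    where
    P : ℤ
    P = + suc ∣ i - j ∣
    i-j≡-k*P : i - j ≡ - k * P
    i-j≡-k*P = begin
      i - j                        ≡⟨ add-multiple-and-cancel i j k P ⟩
      i + k * P - j + (- k) * P    ≡⟨ cong (_+ (- k) * P) e ⟩
      0ℤ + (- k) * P               ≡⟨ +-identityˡ _ ⟩
      - k * P                      ∎

  module _ (R : Rel ℤ 0ℓ) (isCong : IsCongruence _+_ R) where
    open IsCongruence isCong

    ≡⇒R : ∀ {x y} → x ≡ y → R x y
    ≡⇒R {x} refl = refl′ x

    R⇒kernel : ∀ {x y} → R x y → R (x - y) 0ℤ
    R⇒kernel {x} {y} r = subst (R (x - y)) (+-inverseʳ y) (compatible r (refl′ (- y)))

    kernel⇒R : ∀ {x y} → R (x - y) 0ℤ → R x y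
    kernel⇒R {x} {y} r = subst₂ R (sub-add x y) (+-identityˡ y) (compatible r (refl′ y))
      where
      sub-add : ∀ x y → x - y + y ≡ x
      sub-add = solve-∀

    kernel-neg : ∀ {h} → R h 0ℤ → R (- h) 0ℤ
    kernel-neg {h} r = subst₂ R (+-identityʳ (- h)) (+-inverseˡ h) (compatible (refl′ (- h)) (sym′ r))

    kernel-+* : ∀ {h} → R h 0ℤ → ∀ n → R (+ n * h) 0ℤ
    kernel-+* r zero        = refl′ 0ℤ
    kernel-+* {h} r (suc n) = subst (λ z → R z 0ℤ) (sym (suc-* (+ n) h)) (compatible r (kernel-+* r n))

    kernel-* : ∀ {h} → R h 0ℤ → ∀ k → R (k * h) 0ℤ
    kernel-* r (+ n)        = kernel-+* r n
    kernel-* {h} r -[1+ n ] = subst (λ z → R z 0ℤ) (neg-distribˡ-* +[1+ n ] h) (kernel-neg (kernel-+* r (suc n)))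

    JoinModulo : ℕ → Rel ℤ 0ℓ
    JoinModulo p x y = ∃ λ k → R (x + k * + p) y

    R⊆joinModulo : ∀ p → R ⇒ JoinModulo p
    R⊆joinModulo p {x} r = 0ℤ , subst (λ z → R z _) (sym (+-identityʳ x)) r

    joinModulo-isCongruence : ∀ p → IsCongruence _+_ (JoinModulo p)
    joinModulo-isCongruence p = record
      { refl′      = λ x → R⊆joinModulo p (refl′ x)
      ; sym′       = λ { {x} {y} (k , r) → - k ,
          sym′ (subst (λ z → R z (y + (- k) * P)) (cancel-multiple x k P) (compatible r (refl′ ((- k) * P)))) }
      ; trans′     = λ { {x} {y} (k , r) (l , s) → k + l ,
          trans′ (subst (λ z → R z (y + l * P)) (merge-multiples x k l P) (compatible r (refl′ (l * P)))) s }
      ; compatible = λ { {x} {y} {x′} {y′} (k , r) (l , s) → k + l ,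
          subst (λ z → R z (y + y′)) (interchange-multiples x k x′ l P) (compatible r s) }
      }
      where
      P : ℤ
      P = + p

    joinModulo-finitelyManyClasses : ∀ p → FinitelyManyClasses _+_ (JoinModulo (suc p))
    joinModulo-finitelyManyClasses p = suc p , (λ i → + toℕ i) ,
      λ x → fromℕ< (n%d<d x P) , - (x / P) , ≡⇒R (reduce x)
      where
      P : ℤ
      P = + suc p
      reduce : ∀ x → x + - (x / P) * P ≡ + toℕ (fromℕ< (n%d<d x P))
      reduce x = begin
        x + - (x / P) * P                        ≡⟨ cong (_+ - (x / P) * P) (a≡a%n+[a/n]*n x P) ⟩
        + (x % P) + (x / P) * P + - (x / P) * P  ≡⟨ cancel-multiple _ (x / P) P ⟩
        + (x % P)                                ≡⟨ cong +_ (sym (toℕ-fromℕ< (n%d<d x P))) ⟩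
        + toℕ (fromℕ< (n%d<d x P))               ∎

    joinModulo⊆R : ∀ {p} → R (+ p) 0ℤ → JoinModulo p ⇒ R
    joinModulo⊆R {p} p∈ker {x} (k , r) =
      trans′ (sym′ (kernel⇒R (subst (λ z → R z 0ℤ) (sym (add-sub x (k * + p))) (kernel-* p∈ker k)))) r
      where
      add-sub : ∀ x y → x + y - x ≡ y
      add-sub = solve-∀

    ⋂joinModulo⊆R : ∀ {a b} → (∀ p → JoinModulo (suc p) a b) → R a b
    ⋂joinModulo⊆R {a} {b} h with h ∣ a - b ∣
    ... | k , r = fromKernel (a + k * P - b) (R⇒kernel r) refl
      where
      P : ℤ
      P = + suc ∣ a - b ∣
      fromKernel : ∀ g → R g 0ℤ → g ≡ a + k * P - b → R a b
      fromKernel (+ zero) _     0≡g = ≡⇒R (i+k*[1+∣i-j∣]-j≡0⇒i≡j a b k (sym 0≡g))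
      fromKernel +[1+ j ] g∈ker _   = joinModulo⊆R g∈ker (h j)
      fromKernel -[1+ j ] g∈ker _   = joinModulo⊆R (kernel-neg g∈ker) (h j)

  +-cResiduallyFinite : c-ResiduallyFinite _+_
  +-cResiduallyFinite R isCong = isIntersectionOf _+_ {P = FiniteIndexCongruence _+_}
    (λ p → JoinModulo R isCong (suc p))
    (λ p → joinModulo-isCongruence R isCong (suc p) , joinModulo-finitelyManyClasses R isCong p)
    (λ p → R⊆joinModulo R isCong (suc p))
    (⋂joinModulo⊆R R isCong)

  ≤-isStablePreorder : IsStablePreorder _+_ _≤_
  ≤-isStablePreorder = record { refl′ = λ _ → ≤-refl ; trans′ = ≤-trans ; compatible = +-mono-≤ }

  finiteIndex⊇≤⇒1≼0 : ∀ {F} → FiniteIndexStablePreorder _+_ F → _≤_ ⇒ F → F 1ℤ 0ℤ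
  finiteIndex⊇≤⇒1≼0 {F} (isSP , _ , r , classOf) ≤⊆F = viaRepresentative (classOf (1ℤ + B))
    where
    open IsStablePreorder isSP
    B : ℤ
    B = max 0ℤ (tabulate r)

    viaRepresentative : (∃ λ j → assocCong _+_ F (1ℤ + B) (r j)) → F 1ℤ 0ℤ
    viaRepresentative (j , 1+B≼rj , _) = trans′ (≤⊆F 1≤1+B-rj) 1+B-rj≼0
      where
      1≤1+B-rj : 1ℤ ≤ 1ℤ + (B - r j)
      1≤1+B-rj = +-monoʳ-≤ 1ℤ (i≤j⇒0≤j-i (tabulate⁻ (xs≤max 0ℤ (tabulate r)) j))
      1+B-rj≼0 : F (1ℤ + (B - r j)) 0ℤ
      1+B-rj≼0 = subst₂ F (+-assoc 1ℤ B (- r j)) (+-inverseʳ (r j)) (compatible 1+B≼rj (refl′ (- r j)))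

  +-not-spResiduallyFinite : ¬ sp-ResiduallyFinite _+_
  +-not-spResiduallyFinite spRF with spRF _≤_ ≤-isStablePreorder
  ... | _ , F , finiteIndex , ≤⇔⋂F = contradiction 1≤0 λ { (+≤+ ()) }
    where
    1≤0 : 1ℤ ≤ 0ℤ
    1≤0 = Equivalence.from (≤⇔⋂F 1ℤ 0ℤ) λ i →
      finiteIndex⊇≤⇒1≼0 (finiteIndex i) (λ x≤y → Equivalence.to (≤⇔⋂F _ _) x≤y i)

proposition5p11 : sp-ResiduallyFinite _+ℕ_ × (c-ResiduallyFinite _+ℤ_ × ¬ sp-ResiduallyFinite _+ℤ_)
proposition5p11 = Naturals.+-spResiduallyFinite , Integers.+-cResiduallyFinite , Integers.+-not-spResiduallyFinite
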